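{- Let $\mu$ be a partition. The staircase rank of $\mu$ equals the number of salient rows of $\mu$. Furthermore, for each $k$, the length $\mu_i$ of the $k$th salient row $i$ counted from the bottom is at least $k$.
   Context: A partition is an infinite weakly decreasing sequence $\mu_1\ge\mu_2\ge\cdots$ of nonnegative integers with finitely many nonzero terms. Row $i$ ($i\ge1$) is salient if there exists $j>i$ with $i+\mu_i\ge j+\mu_j$. The staircase rank of $\mu$ is the largest integer $k$ such that $\mu_i\ge k-i+1$ for $1\le i\le k$. -}

module Defs where

open import Data.Nat using (ℕ; suc; _+_; _∸_; _≤_; _<_; _>_)
open import Data.Product using (Σ; ∃; _×_)
open import Data.List using (List; length; lookup)
open import Data.List.Membership.Propositional using (_∈_)
open import Data.List.Relation.Unary.Linked using (Linked)
open import Data.Fin using (Fin; toℕ)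
open import Function.Bundles using (_⇔_)
open import Relation.Binary.PropositionalEquality using (_≡_)

-- A partition: rows are indexed from 1 (the value `part 0` is irrelevant junk).
-- Weakly decreasing on rows i ≥ 1, with finitely many nonzero rows.
record Partition : Set where
  field
    part     : ℕ → ℕ
    antitone : ∀ {i j} → 1 ≤ i → i ≤ j → part j ≤ part i
    finite   : ∃ λ N → ∀ i → N ≤ i → part i ≡ 0
open Partition public

Salient : Partition → ℕ → Set
Salient μ i = 1 ≤ i × ∃ λ j → i < j × j + part μ j ≤ i + part μ i

HasStaircase : Partition → ℕ → Set
HasStaircase μ k = ∀ i → 1 ≤ i → i ≤ k → suc (k ∸ i) ≤ part μ i

IsStaircaseRank : Partition → ℕ → Set
IsStaircaseRank μ k = HasStaircase μ k × (∀ k′ → HasStaircase μ k′ → k′ ≤ k)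

SalientRowsFromBottom : Partition → List ℕ → Set
SalientRowsFromBottom μ rows = (∀ i → (i ∈ rows) ⇔ Salient μ i) × Linked _>_ rows

module Submission where

-- Write reach(j) = j + μ_j and fix N > 0 with μ_j = 0 for all j ≥ N, so
-- that reach(N) = N ≤ reach(j) for j ≥ N.  Both quantities of the theorem
-- are governed by the suffix minima  low(i) = min { reach(j) | i ≤ j ≤ N }:
--
--   * a row i ≥ 1 is salient  iff  i < N and low(i+1) ≤ reach(i)
--     (row i is "shadowed" by a later row);
--   * since μ is weakly decreasing, reach(i+1) ≤ reach(i) + 1, hence
--     low(i) = low(i+1) when row i is salient and low(i+1) = low(i) + 1
--     otherwise;
--   * so, scanning the rows i = N-1, …, 1 downwards, each salient row keeps
--     low fixed and each other row lowers it by one.  Counting gives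
--     (#salient rows) = low(1) - 1, and the same bookkeeping shows that the
--     k-th salient row from the bottom, i, satisfies k + N ≤ N + μ_i;
--   * μ has a staircase of size k iff k < low(1), so the staircase rank is
--     low(1) - 1 as well.

open import Defs
open import Data.Nat using (ℕ; zero; suc; _+_; _∸_; _≤_; _<_; _>_; _⊓_; z≤n; s≤s; _≤?_; _<?_)
open import Data.Nat.Properties
open import Data.Product using (Σ; ∃; _×_; _,_)
open import Data.Sum using (inj₁; inj₂)
open import Data.List using (List; length; lookup; filter; applyDownFrom)
open import Data.List.Membership.Propositional using (_∈_)
open import Data.List.Membership.Propositional.Properties
  using (∈-filter⁺; ∈-filter⁻; ∈-applyDownFrom⁺; ∈-applyDownFrom⁻)
open import Data.List.Relation.Unary.Linked using (Linked)
open import Data.List.Relation.Unary.Linked.Properties using (filter⁺; applyDownFrom⁺₂)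
open import Data.Fin using (Fin; toℕ)
import Data.Fin as Fin
open import Function.Bundles using (_⇔_; mk⇔; Equivalence)
open import Relation.Unary using (Decidable)
open import Relation.Nullary using (yes; no)
open import Relation.Nullary.Negation using (contradiction)
open import Relation.Binary.PropositionalEquality using (_≡_; refl; sym; trans; cong; subst; module ≡-Reasoning)

staircase-row : ∀ {k i m} → i ≤ k → suc (k ∸ i) ≤ m ⇔ suc k ≤ i + m
staircase-row {k} {i} {m} i≤k = mk⇔ to from
  where
  total : suc (k ∸ i) + i ≡ suc k
  total = cong suc (m∸n+n≡m i≤k)

  to : suc (k ∸ i) ≤ m → suc k ≤ i + m
  to le = begin
    suc k            ≡⟨ sym total ⟩
    suc (k ∸ i) + i  ≤⟨ +-monoˡ-≤ i le ⟩
    m + i            ≡⟨ +-comm m i ⟩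
    i + m            ∎
    where open ≤-Reasoning

  from : suc k ≤ i + m → suc (k ∸ i) ≤ m
  from le = +-cancelʳ-≤ i _ _ (begin
    suc (k ∸ i) + i  ≡⟨ total ⟩
    suc k            ≤⟨ le ⟩
    i + m            ≡⟨ +-comm i m ⟩
    m + i            ∎)
    where open ≤-Reasoning

module SuffixMinimum (f : ℕ → ℕ) where

  minOver : ℕ → ℕ → ℕ
  minOver zero    i = f i
  minOver (suc t) i = f i ⊓ minOver t (suc i)

  minOver-≤ : ∀ t {i j} → i ≤ j → j ≤ t + i → minOver t i ≤ f j
  minOver-≤ zero    i≤j j≤i rewrite ≤-antisym i≤j j≤i = ≤-refl
  minOver-≤ (suc t) {i} {j} i≤j j≤t+i with m≤n⇒m<n∨m≡n i≤j
  ... | inj₂ refl = m⊓n≤m _ _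
  ... | inj₁ i<j  = ≤-trans (m⊓n≤n _ _) (minOver-≤ t i<j (subst (j ≤_) (sym (+-suc t i)) j≤t+i))

  minOver-attained : ∀ t i → ∃ λ j → i ≤ j × j ≤ t + i × minOver t i ≡ f j
  minOver-attained zero    i = i , ≤-refl , ≤-refl , refl
  minOver-attained (suc t) i with f i ≤? minOver t (suc i)
  ... | yes here = i , ≤-refl , m≤n+m i (suc t) , m≤n⇒m⊓n≡m here
  ... | no later with minOver-attained t (suc i)
  ...   | j , i<j , j≤ , eq =
          j , <⇒≤ i<j , subst (j ≤_) (+-suc t i) j≤ , trans (m≥n⇒m⊓n≡n (<⇒≤ (≰⇒> later))) eq

module FixedPartition (μ : Partition) (L : ℕ) (vanish : ∀ i → suc L ≤ i → part μ i ≡ 0) where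

  N : ℕ
  N = suc L

  reach : ℕ → ℕ
  reach j = j + part μ j

  reach-N : reach N ≡ N
  reach-N = trans (cong (N +_) (vanish N ≤-refl)) (+-identityʳ N)

  reach-beyond : ∀ {j} → N ≤ j → N ≤ reach j
  reach-beyond N≤j = ≤-trans N≤j (m≤m+n _ _)

  reach-suc : ∀ {i} → 1 ≤ i → reach (suc i) ≤ suc (reach i)
  reach-suc {i} 1≤i = s≤s (+-monoʳ-≤ i (antitone μ 1≤i (n≤1+n i)))

  open SuffixMinimum reach

  low : ℕ → ℕ
  low i = minOver (N ∸ i) i

  low-≤ : ∀ {i j} → i ≤ j → j ≤ N → low i ≤ reach j
  low-≤ {i} {j} i≤j j≤N = minOver-≤ (N ∸ i) i≤j (subst (j ≤_) (sym (m∸n+n≡m (≤-trans i≤j j≤N))) j≤N)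

  low-attained : ∀ {i} → i ≤ N → ∃ λ j → i ≤ j × j ≤ N × low i ≡ reach j
  low-attained {i} i≤N with minOver-attained (N ∸ i) i
  ... | j , i≤j , j≤ , eq = j , i≤j , subst (j ≤_) (m∸n+n≡m i≤N) j≤ , eq

  low-N : low N ≡ N
  low-N rewrite n∸n≡0 N = reach-N

  low-step : ∀ {i} → i < N → low i ≡ reach i ⊓ low (suc i)
  low-step (s≤s i≤L) rewrite +-∸-assoc 1 i≤L = refl

  Shadowed : ℕ → Set
  Shadowed i = low (suc i) ≤ reach i

  -- Kept opaque so that case analysis on it also unfolds the filter below.
  opaque
    shadowed? : Decidable Shadowed
    shadowed? i = low (suc i) ≤? reach i

  salient⇒<N : ∀ {i} → Salient μ i → i < N
  salient⇒<N {i} (_ , j , i<j , reach-j≤) with i <? N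
  ... | yes i<N = i<N
  ... | no i≮N = contradiction reach-j≤ (<⇒≱ (begin-strict
        i + part μ i  ≡⟨ cong (i +_) (vanish i (≮⇒≥ i≮N)) ⟩
        i + 0         ≡⟨ +-identityʳ i ⟩
        i             <⟨ i<j ⟩
        j             ≤⟨ m≤m+n j _ ⟩
        reach j       ∎))
    where open ≤-Reasoning

  -- Among the rows above N, salience is exactly being shadowed: a witness
  -- j beyond N may be replaced by N itself.
  salient⇔shadowed : ∀ {i} → 1 ≤ i → i < N → Salient μ i ⇔ Shadowed i
  salient⇔shadowed {i} 1≤i i<N = mk⇔ to from
    where
    to : Salient μ i → Shadowed i
    to (_ , j , i<j , reach-j≤) with ≤-total j N
    ... | inj₁ j≤N = ≤-trans (low-≤ i<j j≤N) reach-j≤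
    ... | inj₂ N≤j = begin
          low (suc i)  ≤⟨ low-≤ i<N ≤-refl ⟩
          reach N      ≡⟨ reach-N ⟩
          N            ≤⟨ reach-beyond N≤j ⟩
          reach j      ≤⟨ reach-j≤ ⟩
          reach i      ∎
      where open ≤-Reasoning

    from : Shadowed i → Salient μ i
    from shadowed with low-attained i<N
    ... | j , i<j , _ , eq = 1≤i , j , i<j , subst (_≤ reach i) eq shadowed

  low-shadowed : ∀ {i} → i < N → Shadowed i → low i ≡ low (suc i)
  low-shadowed i<N shadowed = trans (low-step i<N) (m≥n⇒m⊓n≡n shadowed)

  low-unshadowed : ∀ {i} → 1 ≤ i → i < N → reach i < low (suc i) → low (suc i) ≡ suc (low i)
  low-unshadowed {i} 1≤i i<N reach<low = begin-equality
    low (suc i)   ≡⟨ ≤-antisym (≤-trans (low-≤ ≤-refl i<N) (reach-suc 1≤i)) reach<low ⟩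
    suc (reach i) ≡⟨ cong suc (sym low-i) ⟩
    suc (low i)   ∎
    where
    open ≤-Reasoning
    low-i : low i ≡ reach i
    low-i = trans (low-step i<N) (m≤n⇒m⊓n≡m (<⇒≤ reach<low))

  shadowedUpTo : ℕ → List ℕ
  shadowedUpTo n = filter shadowed? (applyDownFrom suc n)

  -- Counting invariant of the downward scan: every row of 1 … n that is not
  -- shadowed lowers the suffix minimum by one.
  length-shadowedUpTo : ∀ {n} → n ≤ L → length (shadowedUpTo n) + low (suc n) ≡ low 1 + n
  length-shadowedUpTo {zero}  _   = sym (+-identityʳ _)
  length-shadowedUpTo {suc n} n<L with shadowed? (suc n)
  ... | yes shadowed = begin
        suc (length (shadowedUpTo n) + low (suc (suc n)))  ≡⟨ cong (λ m → suc (length (shadowedUpTo n) + m)) (sym (low-shadowed (s≤s n<L) shadowed)) ⟩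
        suc (length (shadowedUpTo n) + low (suc n))        ≡⟨ cong suc (length-shadowedUpTo (<⇒≤ n<L)) ⟩
        suc (low 1 + n)                                    ≡⟨ sym (+-suc _ n) ⟩
        low 1 + suc n                                      ∎
    where open ≡-Reasoning
  ... | no unshadowed = begin
        length (shadowedUpTo n) + low (suc (suc n))        ≡⟨ cong (length (shadowedUpTo n) +_) (low-unshadowed (s≤s z≤n) (s≤s n<L) (≰⇒> unshadowed)) ⟩
        length (shadowedUpTo n) + suc (low (suc n))        ≡⟨ +-suc _ _ ⟩
        suc (length (shadowedUpTo n) + low (suc n))        ≡⟨ cong suc (length-shadowedUpTo (<⇒≤ n<L)) ⟩
        suc (low 1 + n)                                    ≡⟨ sym (+-suc _ n) ⟩
        low 1 + suc n                                      ∎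
    where open ≡-Reasoning

  lookup-shadowedUpTo : ∀ {n} → n ≤ L → (q : Fin (length (shadowedUpTo n))) →
    suc (toℕ q) + low (suc n) ≤ suc n + part μ (lookup (shadowedUpTo n) q)
  lookup-shadowedUpTo {suc n} n<L q with shadowed? (suc n)
  lookup-shadowedUpTo {suc n} n<L Fin.zero    | yes shadowed = s≤s shadowed
  lookup-shadowedUpTo {suc n} n<L (Fin.suc q) | yes shadowed =
    s≤s (subst (λ m → suc (toℕ q) + m ≤ suc n + part μ (lookup (shadowedUpTo n) q))
               (low-shadowed (s≤s n<L) shadowed)
               (lookup-shadowedUpTo (<⇒≤ n<L) q))
  lookup-shadowedUpTo {suc n} n<L q | no unshadowed = begin
    suc (toℕ q) + low (suc (suc n))        ≡⟨ cong (suc (toℕ q) +_) (low-unshadowed (s≤s z≤n) (s≤s n<L) (≰⇒> unshadowed)) ⟩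
    suc (toℕ q) + suc (low (suc n))        ≡⟨ +-suc (suc (toℕ q)) _ ⟩
    suc (suc (toℕ q) + low (suc n))        ≤⟨ s≤s (lookup-shadowedUpTo (<⇒≤ n<L) q) ⟩
    suc (suc n + part μ (lookup (shadowedUpTo n) q)) ∎
    where open ≤-Reasoning

  rows : List ℕ
  rows = shadowedUpTo L

  rows-salient : SalientRowsFromBottom μ rows
  rows-salient = (λ i → mk⇔ to from) , filter⁺ shadowed? (λ j<i k<j → <-trans k<j j<i) descending
    where
    descending : Linked _>_ (applyDownFrom suc L)
    descending = applyDownFrom⁺₂ suc L (λ i → n<1+n (suc i))

    to : ∀ {i} → i ∈ rows → Salient μ i
    to i∈ with ∈-filter⁻ shadowed? {xs = applyDownFrom suc L} i∈
    ... | i∈range , shadowed with ∈-applyDownFrom⁻ suc i∈range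
    ...   | _ , j<L , refl = Equivalence.from (salient⇔shadowed (s≤s z≤n) (s≤s j<L)) shadowed

    from : ∀ {i} → Salient μ i → i ∈ rows
    from {suc j} salient with salient⇒<N salient
    ... | s≤s j<L = ∈-filter⁺ shadowed? (∈-applyDownFrom⁺ suc j<L)
                      (Equivalence.to (salient⇔shadowed (s≤s z≤n) (s≤s j<L)) salient)
    from {zero} (() , _)

  length-rows : suc (length rows) ≡ low 1
  length-rows = +-cancelʳ-≡ L _ _ (begin
    suc (length rows) + L    ≡⟨ sym (+-suc (length rows) L) ⟩
    length rows + N          ≡⟨ cong (length rows +_) (sym low-N) ⟩
    length rows + low N      ≡⟨ length-shadowedUpTo ≤-refl ⟩
    low 1 + L                ∎)
    where open ≡-Reasoning

  lookup-rows : (q : Fin (length rows)) → suc (toℕ q) ≤ part μ (lookup rows q)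
  lookup-rows q = +-cancelˡ-≤ N _ _ (begin
    N + suc (toℕ q)          ≡⟨ +-comm N _ ⟩
    suc (toℕ q) + N          ≡⟨ cong (suc (toℕ q) +_) (sym low-N) ⟩
    suc (toℕ q) + low N      ≤⟨ lookup-shadowedUpTo ≤-refl q ⟩
    N + part μ (lookup rows q) ∎)
    where open ≤-Reasoning

  staircase⇔ : ∀ {k} → HasStaircase μ k ⇔ suc k ≤ low 1
  staircase⇔ {k} = mk⇔ to from
    where
    to : HasStaircase μ k → suc k ≤ low 1
    to staircase with low-attained (s≤s z≤n)
    ... | j , 1≤j , _ , low1≡ with j ≤? k
    ...   | yes j≤k = subst (suc k ≤_) (sym low1≡)
                        (Equivalence.to (staircase-row j≤k) (staircase j 1≤j j≤k))
    ...   | no j≰k  = subst (suc k ≤_) (sym low1≡) (≤-trans (≰⇒> j≰k) (m≤m+n j _))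

    from : suc k ≤ low 1 → HasStaircase μ k
    from k<low i 1≤i i≤k = Equivalence.from (staircase-row i≤k) (≤-trans k<low (low-≤ 1≤i i≤N))
      where
      i≤N : i ≤ N
      i≤N = ≤-trans i≤k (<⇒≤ (≤-trans k<low (subst (low 1 ≤_) reach-N (low-≤ (s≤s z≤n) ≤-refl))))

  rank-low : ∀ {k} → IsStaircaseRank μ k → suc k ≡ low 1
  rank-low {k} (staircase , maximal) =
    ≤-antisym (Equivalence.to staircase⇔ staircase) (below (low 1) ≤-refl)
    where
    below : ∀ m → m ≤ low 1 → m ≤ suc k
    below zero    _    = z≤n
    below (suc m) m<low = s≤s (maximal m (Equivalence.from staircase⇔ m<low))

lemma16 : (μ : Partition) (k : ℕ) → IsStaircaseRank μ k →
    Σ (List ℕ) λ rows → SalientRowsFromBottom μ rows × length rows ≡ k ×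
    ((p : Fin (length rows)) → suc (toℕ p) ≤ part μ (lookup rows p))
lemma16 μ k rank with finite μ
... | L , vanish =
  rows , rows-salient , suc-injective (trans length-rows (sym (rank-low rank))) , lookup-rows
  where open FixedPartition μ L (λ i L<i → vanish i (<⇒≤ L<i))
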